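{- Let $k\ge1$ be an integer with $k\not\equiv 0\pmod 4$ such that $\mathcal{D}:=(k^2+4)/\gcd(2,k)^2$ is squarefree, let $\alpha=\frac{k+\sqrt{k^2+4}}{2}$, $\beta=\frac{k-\sqrt{k^2+4}}{2}$, let $p\ge3$ be a prime, and let $\mathcal{F}_p(x)=x^{2p}-kx^p-1$. Then $\mathcal{F}_p(\beta)\equiv 0\pmod{p^2}$ if and only if $\mathcal{F}_p(\alpha)\equiv 0\pmod{p^2}$.
   Context: Congruences are in the ring of algebraic integers of $\mathbb{Q}(\sqrt{k^2+4})$. -}

module Defs where

open import Data.Nat as ℕ using (ℕ; zero; suc; NonZero; _^_; _/_; ≢-nonZero)
open import Data.Nat.Divisibility using (_∣_)
open import Data.Nat.GCD using (gcd; gcd[m,n]≢0)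
open import Data.Nat.Properties using (m^n≢0)
open import Data.Integer as ℤ using (ℤ; +_; _+_; _*_; -_; _-_)
open import Data.Product using (Σ; _,_)
open import Data.Sum using (inj₁)
open import Relation.Binary.PropositionalEquality using (_≡_)

SquareFree : ℕ → Set
SquareFree n = ∀ d → (d ℕ.* d) ∣ n → d ≡ 1

private
  gcd2≢0 : ∀ k → NonZero (gcd 2 k ^ 2)
  gcd2≢0 k = m^n≢0 (gcd 2 k) 2 {{≢-nonZero (gcd[m,n]≢0 2 k (inj₁ (λ ())))}}

𝒟 : ℕ → ℕ
𝒟 k = _/_ (k ℕ.* k ℕ.+ 4) (gcd 2 k ^ 2) {{gcd2≢0 k}}

-- Elements a + b·α of ℤ[α], α = (k + √(k²+4))/2, so α² = kα + 1.
-- Under the hypotheses of the lemma this is the ring of algebraic integers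
-- of ℚ(√(k²+4)).
record Zα : Set where
  constructor _+_α
  field
    re : ℤ
    im : ℤ

module _ (k : ℕ) where
  mul : Zα → Zα → Zα
  mul (a + b α) (c + d α) = (a * c + b * d) + (a * d + b * c + (+ k) * b * d) α

  pow : Zα → ℕ → Zα
  pow x zero = (+ 1) + (+ 0) α
  pow x (suc n) = mul x (pow x n)

  sub : Zα → Zα → Zα
  sub (a + b α) (c + d α) = (a - c) + (b - d) α

  ι : ℤ → Zα
  ι m = m + (+ 0) α

  α₀ β₀ : Zα
  α₀ = (+ 0) + (+ 1) α
  β₀ = (+ k) + (- (+ 1)) α      -- β = k - α

  𝓕 : ℕ → Zα → Zα
  𝓕 p x = sub (sub (pow x (2 ℕ.* p)) (mul (ι (+ k)) (pow x p))) (ι (+ 1))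

  Divides : ℤ → Zα → Set
  Divides m x = Σ Zα (λ y → x ≡ mul (ι m) y)

  Cong0 : Zα → ℤ → Set
  Cong0 x m = Divides m x

{-# OPTIONS --safe #-}
module Submission where

open import Defs
open import Data.Nat using (ℕ; zero; suc; _≥_; _^_; _%_; _*_)
open import Data.Nat.Primality using (Prime)
open import Data.Integer using (+_; -_; 1ℤ)
import Data.Integer as ℤ
open import Data.Integer.Properties
  using (+-identityˡ; +-identityʳ; *-identityˡ; +-inverseʳ; -1*i≡-i)
open import Data.Integer.Solver using (module +-*-Solver)
open import Data.Product using (_,_)
open import Relation.Binary.PropositionalEquality
  using (_≡_; _≢_; refl; trans; cong; cong₂; subst; module ≡-Reasoning)
open import Function.Base using (_∘_)
open import Function.Bundles using (_⇔_; mk⇔)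

-- Since α + β = k, the Galois conjugation of ℚ(√(k²+4)) acts on ℤ[α] by
-- a + bα ↦ a + b(k − α).  It is a ring automorphism fixing ℤ and swapping
-- α and β, so it carries 𝓕_p(β) to 𝓕_p(α) and preserves divisibility by any
-- rational integer.

module Conjugation (k : ℕ) where
  open +-*-Solver

  conj : Zα → Zα
  conj (a + b α) = (a ℤ.+ b ℤ.* + k) + (- b) α

  conj-mul : ∀ x y → conj (mul k x y) ≡ mul k (conj x) (conj y)
  conj-mul (a + b α) (c + d α) = cong₂ _+_α
    (solve 5 (λ a b c d K → (a :* c :+ b :* d) :+ (a :* d :+ b :* c :+ K :* b :* d) :* K
                         := (a :+ b :* K) :* (c :+ d :* K) :+ (:- b) :* (:- d))
           refl a b c d (+ k))
    (solve 5 (λ a b c d K → :- (a :* d :+ b :* c :+ K :* b :* d)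
                         := (a :+ b :* K) :* (:- d) :+ (:- b) :* (c :+ d :* K) :+ K :* (:- b) :* (:- d))
           refl a b c d (+ k))

  conj-sub : ∀ x y → conj (sub k x y) ≡ sub k (conj x) (conj y)
  conj-sub (a + b α) (c + d α) = cong₂ _+_α
    (solve 5 (λ a b c d K → (a :- c) :+ (b :- d) :* K := (a :+ b :* K) :- (c :+ d :* K))
           refl a b c d (+ k))
    (solve 2 (λ b d → :- (b :- d) := (:- b) :- (:- d)) refl b d)

  conj-ι : ∀ m → conj (ι k m) ≡ ι k m
  conj-ι m = cong₂ _+_α (+-identityʳ m) refl

  conj-scale : ∀ m x → conj (mul k (ι k m) x) ≡ mul k (ι k m) (conj x)
  conj-scale m x = trans (conj-mul (ι k m) x) (cong (λ c → mul k c (conj x)) (conj-ι m))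

  conj-pow : ∀ x n → conj (pow k x n) ≡ pow k (conj x) n
  conj-pow x zero    = refl
  conj-pow x (suc n) = trans (conj-mul x (pow k x n)) (cong (mul k (conj x)) (conj-pow x n))

  conj-𝓕 : ∀ p x → conj (𝓕 k p x) ≡ 𝓕 k p (conj x)
  conj-𝓕 p x = begin
    conj (sub k (sub k x^2p kx^p) one)
      ≡⟨ conj-sub (sub k x^2p kx^p) one ⟩
    sub k (conj (sub k x^2p kx^p)) (conj one)
      ≡⟨ cong₂ (sub k) (conj-sub x^2p kx^p) (conj-ι (+ 1)) ⟩
    sub k (sub k (conj x^2p) (conj kx^p)) one
      ≡⟨ cong₂ (λ u v → sub k (sub k u v) one)
               (conj-pow x (2 * p))
               (trans (conj-scale (+ k) (pow k x p)) (cong (mul k (ι k (+ k))) (conj-pow x p))) ⟩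
    𝓕 k p (conj x)
      ∎
    where
    open ≡-Reasoning
    x^2p kx^p one : Zα
    x^2p = pow k x (2 * p)
    kx^p = mul k (ι k (+ k)) (pow k x p)
    one  = ι k (+ 1)

  conj-α₀ : conj (α₀ k) ≡ β₀ k
  conj-α₀ = cong₂ _+_α (trans (+-identityˡ (1ℤ ℤ.* + k)) (*-identityˡ (+ k))) refl

  conj-β₀ : conj (β₀ k) ≡ α₀ k
  conj-β₀ = cong₂ _+_α (trans (cong (ℤ._+_ (+ k)) (-1*i≡-i (+ k))) (+-inverseʳ (+ k))) refl

  conj-Cong0 : ∀ {x} m → Cong0 k x m → Cong0 k (conj x) m
  conj-Cong0 m (y , x≡my) = conj y , trans (cong conj x≡my) (conj-scale m y)

  Cong0-𝓕-conj : ∀ p m x → Cong0 k (𝓕 k p x) m → Cong0 k (𝓕 k p (conj x)) m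
  Cong0-𝓕-conj p m x = subst (λ z → Cong0 k z m) (conj-𝓕 p x) ∘ conj-Cong0 m

open Conjugation

lemma3p3 : (k : ℕ) → k ≥ 1 → k % 4 ≢ 0 → SquareFree (𝒟 k)
         → (p : ℕ) → Prime p → p ≥ 3
         → Cong0 k (𝓕 k p (β₀ k)) (+ (p ^ 2)) ⇔ Cong0 k (𝓕 k p (α₀ k)) (+ (p ^ 2))
lemma3p3 k _ _ _ p _ _ = mk⇔
  (subst 𝓕≡0 (conj-β₀ k) ∘ Cong0-𝓕-conj k p (+ (p ^ 2)) (β₀ k))
  (subst 𝓕≡0 (conj-α₀ k) ∘ Cong0-𝓕-conj k p (+ (p ^ 2)) (α₀ k))
  where
  𝓕≡0 : Zα → Set
  𝓕≡0 x = Cong0 k (𝓕 k p x) (+ (p ^ 2))
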